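{- For every integer $n\geq 1$ the following two polynomial identities hold: \[ \sum_{i=0}^{n}\sum_{j=0}^{\lfloor (n-i)/2\rfloor}\binom{n}{i}\binom{n-i}{j}\binom{n-j-i}{j}x^jy^i=\sum_{k=0}^{\lfloor n/2\rfloor}\binom{n}{2k}\binom{2k}{k}x^k(1+y)^{n-2k}, \] \[ \sum_{i=0}^{n}\sum_{j=0}^{\lfloor (n-i)/2\rfloor}\binom{n}{i}\binom{n-i}{j}\binom{n-j-i}{j}x^{2j}y^iz^{n-2j-i}=\sum_{k=0}^{n}\binom{n}{k}\binom{2k}{k}x^k(y+z-2x)^{n-k}. \] -}

module Defs where

open import Level using (Level)
open import Data.Nat as ℕ using (ℕ; zero; suc)
open import Algebra.Bundles using (CommutativeRing)

module RingOps {c ℓ : Level} (R : CommutativeRing c ℓ) where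
  open CommutativeRing R using (Carrier; _+_; _*_; 0#; 1#)

  _·_ : ℕ → Carrier → Carrier
  zero  · x = 0#
  suc k · x = x + (k · x)

  _^_ : Carrier → ℕ → Carrier
  x ^ zero  = 1#
  x ^ suc k = x * (x ^ k)

  Σ≤ : ℕ → (ℕ → Carrier) → Carrier
  Σ≤ zero    f = f zero
  Σ≤ (suc n) f = Σ≤ n f + f (suc n)

  infixl 7 _·_
  infixr 8 _^_

module Submission where

open import Defs
open import Data.Nat using (ℕ; _≥_; _∸_) renaming (_*_ to _*ℕ_)
open import Data.Nat.DivMod using (_/_)
open import Data.Nat.Combinatorics using (_C_)
open import Data.Product using (_×_)
open import Algebra.Bundles using (CommutativeRing)
open import Data.Product using (_,_)
open import Data.Nat.DivMod using (m/n≤m)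
open import Data.Nat.Combinatorics using (k>n⇒nCk≡0)
open import Level using (Level)
open import Data.Nat as ℕ using (zero; suc; z≤n; s≤s)
import Data.Nat.Properties as ℕ
open import Data.Fin using (toℕ)
open import Data.Sum using (inj₁; inj₂)
open import Data.Empty using (⊥-elim)
open import Function using (_∘_)
open import Relation.Nullary using (yes; no)
open import Relation.Binary.PropositionalEquality as ≡ using (_≡_; _≢_)
import Algebra.Construct.Pointwise as Pointwise
import Algebra.Properties.CommutativeSemigroup as CommutativeSemigroupProperties

-- Theorem 2.5: two identities for sums of trinomial coefficients, valid in every
-- commutative ring.  Write trinomial n i j = C(n,i) C(n-i,j) C(n-i-j,j) and
-- paired n j = C(n,2j) C(2j,j).
--
-- * BinomialCoefficients: trinomial n i j = paired n j · C(n-2j,i), and it vanishes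
--   once 2j > n - i.  Both follow from C(n,a) C(n-a,b) = C(n,a+b) C(a+b,a).
-- * RingSums: the laws of the finite sums Σ≤ and of the operations · and ^ of Defs,
--   and the binomial theorem (transferred from the library).
-- * PowerSeries, CentralBinomial: the central binomial identity
--     Σ_j paired n j · x²ʲ (b + 2x)ⁿ⁻²ʲ = Σ_k C(n,k) C(2k,k) · xᵏ bⁿ⁻ᵏ,
--   obtained by comparing the coefficients of tⁿ in
--   (x (t² + 1) + (b + 2x) t)ⁿ = (x (t + 1)² + b t)ⁿ, computed in the ring of formal
--   power series over R: [tᵏ] (t + 1)²ᵏ = C(2k,k), while [tᵐ] (t² + 1)ᵐ is C(m, m/2)
--   for even m and 0 for odd m.
-- * TrinomialSums: extending the inner sums to j ≤ n and swapping the order of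
--   summation, each inner sum over i becomes a binomial expansion.  This gives the
--   first identity outright, and the second with b = y + z - 2x via the central
--   binomial identity.

module BinomialCoefficients where

  open import Data.Nat
  open import Data.Nat.Properties
  open import Data.Nat.Combinatorics
  open import Data.Nat.DivMod using (_%_; m*[n/m]≡n; m≡m%n+[m/n]*n; m%n<n)
  open import Data.Nat.Solver using (module +-*-Solver)
  open import Relation.Binary.PropositionalEquality
  open +-*-Solver using (solve; _:*_; _:=_)
  open import Algebra.Properties.CommutativeSemigroup *-commutativeSemigroup
    using (xy∙z≈xz∙y)

  choose-factorial : ∀ {n k} → k ≤ n → k ! * (n ∸ k) ! * (n C k) ≡ n !
  choose-factorial {n} {k} k≤n =
    trans (cong (k ! * (n ∸ k) ! *_) (nCk≡n!/k![n-k]! k≤n))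
          (m*[n/m]≡n {{k !* (n ∸ k) !≢0}} (k![n∸k]!∣n! k≤n))

  -- For a + b ≤ n, choosing a elements and then b of the remaining ones is the same
  -- as choosing a + b elements and then a of them: both count the splittings of n
  -- into groups of sizes a, b and n - a - b, i.e. n! / (a! b! (n - a - b)!).
  choose-choose-≤ : ∀ {n a b} → a + b ≤ n → (n C a) * ((n ∸ a) C b) ≡ (n C (a + b)) * ((a + b) C a)
  choose-choose-≤ {n} {a} {b} a+b≤n = *-cancelʳ-≡ _ _ (a ! * b ! * m !) {{rest≢0}} (trans left (sym right))
    where
    open ≡-Reasoning
    m = n ∸ (a + b)
    rest≢0 : NonZero (a ! * b ! * m !)
    rest≢0 = m*n≢0 (a ! * b !) (m !) {{a !* b !≢0}} {{m !≢0}}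
    b≤n∸a : b ≤ n ∸ a
    b≤n∸a = subst (_≤ n ∸ a) (m+n∸m≡n a b) (∸-monoˡ-≤ a a+b≤n)
    remaining : b ! * m ! * ((n ∸ a) C b) ≡ (n ∸ a) !
    remaining = subst (λ t → b ! * t ! * ((n ∸ a) C b) ≡ (n ∸ a) !)
                      (∸-+-assoc n a b) (choose-factorial b≤n∸a)
    chosen : a ! * b ! * ((a + b) C a) ≡ (a + b) !
    chosen = subst (λ t → a ! * t ! * ((a + b) C a) ≡ (a + b) !)
                   (m+n∸m≡n a b) (choose-factorial (m≤m+n a b))
    left : (n C a) * ((n ∸ a) C b) * (a ! * b ! * m !) ≡ n !
    left = begin
      (n C a) * ((n ∸ a) C b) * (a ! * b ! * m !)
        ≡⟨ solve 5 (λ X Y A B M → X :* Y :* (A :* B :* M) := A :* (B :* M :* Y) :* X)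
                 refl (n C a) ((n ∸ a) C b) (a !) (b !) (m !) ⟩
      a ! * (b ! * m ! * ((n ∸ a) C b)) * (n C a)  ≡⟨ cong (λ u → a ! * u * (n C a)) remaining ⟩
      a ! * (n ∸ a) ! * (n C a)                    ≡⟨ choose-factorial (≤-trans (m≤m+n a b) a+b≤n) ⟩
      n !                                          ∎
    right : (n C (a + b)) * ((a + b) C a) * (a ! * b ! * m !) ≡ n !
    right = begin
      (n C (a + b)) * ((a + b) C a) * (a ! * b ! * m !)
        ≡⟨ solve 5 (λ X Y A B M → X :* Y :* (A :* B :* M) := A :* B :* Y :* M :* X)
                 refl (n C (a + b)) ((a + b) C a) (a !) (b !) (m !) ⟩
      a ! * b ! * ((a + b) C a) * m ! * (n C (a + b))  ≡⟨ cong (λ u → u * m ! * (n C (a + b))) chosen ⟩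
      (a + b) ! * m ! * (n C (a + b))                  ≡⟨ choose-factorial a+b≤n ⟩
      n !                                              ∎

  choose-choose-> : ∀ {n a b} → n < a + b → (n C a) * ((n ∸ a) C b) ≡ 0
  choose-choose-> {n} {a} {b} n<a+b with a ≤? n
  ... | no a≰n rewrite k>n⇒nCk≡0 (≰⇒> a≰n) = refl
  ... | yes a≤n = trans (cong ((n C a) *_) (k>n⇒nCk≡0 n∸a<b)) (*-zeroʳ (n C a))
    where
    n∸a<b : n ∸ a < b
    n∸a<b = subst (n ∸ a <_) (m+n∸m≡n a b) (∸-monoˡ-< n<a+b a≤n)

  choose-choose : ∀ n a b → (n C a) * ((n ∸ a) C b) ≡ (n C (a + b)) * ((a + b) C a)
  choose-choose n a b with a + b ≤? n
  ... | yes a+b≤n = choose-choose-≤ {n} {a} {b} a+b≤n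
  ... | no a+b≰n = trans (choose-choose-> {n} {a} {b} (≰⇒> a+b≰n))
                         (sym (cong (_* ((a + b) C a)) (k>n⇒nCk≡0 (≰⇒> a+b≰n))))

  choose-swap : ∀ n a b → (n C a) * ((n ∸ a) C b) ≡ (n C b) * ((n ∸ b) C a)
  choose-swap n a b = begin
    (n C a) * ((n ∸ a) C b)        ≡⟨ choose-choose n a b ⟩
    (n C (a + b)) * ((a + b) C a)  ≡⟨ cong₂ (λ s t → (n C s) * t) (+-comm a b) symmetric ⟩
    (n C (b + a)) * ((b + a) C b)  ≡⟨ choose-choose n b a ⟨
    (n C b) * ((n ∸ b) C a)        ∎
    where
    open ≡-Reasoning
    symmetric : (a + b) C a ≡ (b + a) C b
    symmetric = trans (nCk≡nC[n∸k] (m≤m+n a b))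
                      (cong₂ _C_ (+-comm a b) (m+n∸m≡n a b))

  ∸-exchange : ∀ m n o → m ∸ n ∸ o ≡ m ∸ o ∸ n
  ∸-exchange m n o = trans (∸-+-assoc m n o) (trans (cong (m ∸_) (+-comm n o)) (sym (∸-+-assoc m o n)))

  -- The trinomial coefficient n! / (i! j! j! (n - i - 2j)!) in the form in which it
  -- appears in the theorem: choose i elements, then j, then j more.
  trinomial : ℕ → ℕ → ℕ → ℕ
  trinomial n i j = (n C i) * ((n ∸ i) C j) * ((n ∸ j ∸ i) C j)

  paired : ℕ → ℕ → ℕ
  paired n j = (n C (2 * j)) * ((2 * j) C j)

  trinomial-pairs : ∀ n i j → trinomial n i j ≡ (n C i) * ((n ∸ i) C (2 * j)) * ((2 * j) C j)
  trinomial-pairs n i j = begin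
    (n C i) * ((n ∸ i) C j) * ((n ∸ j ∸ i) C j)
      ≡⟨ cong (λ t → (n C i) * ((n ∸ i) C j) * (t C j)) (∸-exchange n j i) ⟩
    (n C i) * ((n ∸ i) C j) * ((n ∸ i ∸ j) C j)
      ≡⟨ *-assoc (n C i) _ _ ⟩
    (n C i) * (((n ∸ i) C j) * ((n ∸ i ∸ j) C j))
      ≡⟨ cong ((n C i) *_) (choose-choose (n ∸ i) j j) ⟩
    (n C i) * (((n ∸ i) C (j + j)) * ((j + j) C j))
      ≡⟨ *-assoc (n C i) _ _ ⟨
    (n C i) * ((n ∸ i) C (j + j)) * ((j + j) C j)
      ≡⟨ cong (λ t → (n C i) * ((n ∸ i) C t) * (t C j)) (cong (j +_) (+-identityʳ j)) ⟨
    (n C i) * ((n ∸ i) C (2 * j)) * ((2 * j) C j) ∎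
    where open ≡-Reasoning

  trinomial-reorder : ∀ n i j → trinomial n i j ≡ paired n j * ((n ∸ 2 * j) C i)
  trinomial-reorder n i j = begin
    (n C i) * ((n ∸ i) C j) * ((n ∸ j ∸ i) C j)        ≡⟨ trinomial-pairs n i j ⟩
    (n C i) * ((n ∸ i) C (2 * j)) * ((2 * j) C j)      ≡⟨ cong (_* ((2 * j) C j)) (choose-swap n i (2 * j)) ⟩
    (n C (2 * j)) * ((n ∸ 2 * j) C i) * ((2 * j) C j)  ≡⟨ xy∙z≈xz∙y (n C (2 * j)) _ _ ⟩
    (n C (2 * j)) * ((2 * j) C j) * ((n ∸ 2 * j) C i)  ∎
    where open ≡-Reasoning

  trinomial-vanishes : ∀ n i j → n ∸ i < 2 * j → trinomial n i j ≡ 0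
  trinomial-vanishes n i j n∸i<2j = begin
    (n C i) * ((n ∸ i) C j) * ((n ∸ j ∸ i) C j)    ≡⟨ trinomial-pairs n i j ⟩
    (n C i) * ((n ∸ i) C (2 * j)) * ((2 * j) C j)  ≡⟨ cong (λ t → (n C i) * t * ((2 * j) C j)) (k>n⇒nCk≡0 n∸i<2j) ⟩
    (n C i) * 0 * ((2 * j) C j)                    ≡⟨ cong (_* ((2 * j) C j)) (*-zeroʳ (n C i)) ⟩
    0 ∎
    where open ≡-Reasoning

  half<⇒< : ∀ m j → m / 2 < j → m < 2 * j
  half<⇒< m j m/2<j = begin-strict
    m                    ≡⟨ m≡m%n+[m/n]*n m 2 ⟩
    m % 2 + (m / 2) * 2  <⟨ +-monoˡ-< ((m / 2) * 2) (m%n<n m 2) ⟩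
    suc (m / 2) * 2      ≤⟨ *-monoˡ-≤ 2 m/2<j ⟩
    j * 2                ≡⟨ *-comm j 2 ⟩
    2 * j                ∎
    where open ≤-Reasoning

open BinomialCoefficients

module RingSums {c ℓ : Level} (R : CommutativeRing c ℓ) where
  open CommutativeRing R
  open RingOps R
  open import Relation.Binary.Reasoning.Setoid setoid
  open import Algebra.Properties.CommutativeSemigroup +-commutativeSemigroup using (interchange)
  open import Algebra.Properties.CommutativeSemigroup *-commutativeSemigroup
    using () renaming (interchange to *-interchange)
  import Algebra.Properties.Monoid.Sum +-monoid as LibSum
  import Algebra.Properties.Monoid.Mult +-monoid as LibMult
  import Algebra.Properties.Semiring.Exp semiring as LibExp
  import Algebra.Properties.Semiring.Binomial semiring as LibBinomial

  Σ-cong : ∀ n {f g : ℕ → Carrier} → (∀ i → i ℕ.≤ n → f i ≈ g i) → Σ≤ n f ≈ Σ≤ n g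
  Σ-cong zero    f≈g = f≈g 0 z≤n
  Σ-cong (suc n) f≈g = +-cong (Σ-cong n (λ i i≤n → f≈g i (ℕ.m≤n⇒m≤1+n i≤n))) (f≈g (suc n) ℕ.≤-refl)

  Σ-zero : ∀ n (f : ℕ → Carrier) → (∀ i → i ℕ.≤ n → f i ≈ 0#) → Σ≤ n f ≈ 0#
  Σ-zero n f f≈0 = trans (Σ-cong n f≈0) (constant-zero n)
    where
    constant-zero : ∀ n → Σ≤ n (λ _ → 0#) ≈ 0#
    constant-zero zero    = refl
    constant-zero (suc n) = trans (+-identityʳ _) (constant-zero n)

  Σ-+ : ∀ n (f g : ℕ → Carrier) → Σ≤ n (λ i → f i + g i) ≈ Σ≤ n f + Σ≤ n g
  Σ-+ zero    f g = refl
  Σ-+ (suc n) f g = trans (+-congʳ (Σ-+ n f g)) (interchange _ _ _ _)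

  Σ-*ˡ : ∀ n a (f : ℕ → Carrier) → a * Σ≤ n f ≈ Σ≤ n (λ i → a * f i)
  Σ-*ˡ zero    a f = refl
  Σ-*ˡ (suc n) a f = trans (distribˡ a _ _) (+-congʳ (Σ-*ˡ n a f))

  Σ-*ʳ : ∀ n a (f : ℕ → Carrier) → Σ≤ n f * a ≈ Σ≤ n (λ i → f i * a)
  Σ-*ʳ zero    a f = refl
  Σ-*ʳ (suc n) a f = trans (distribʳ a _ _) (+-congʳ (Σ-*ʳ n a f))

  Σ-front : ∀ n (f : ℕ → Carrier) → Σ≤ (suc n) f ≈ f 0 + Σ≤ n (f ∘ suc)
  Σ-front zero    f = refl
  Σ-front (suc n) f = trans (+-congʳ (Σ-front n f)) (+-assoc _ _ _)

  Σ-extend : ∀ m N (f : ℕ → Carrier) → m ℕ.≤ N → (∀ i → m ℕ.< i → i ℕ.≤ N → f i ≈ 0#) →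
             Σ≤ m f ≈ Σ≤ N f
  Σ-extend m zero    f z≤n  _      = refl
  Σ-extend m (suc N) f m≤N+1 f≈0 with ℕ.m≤n⇒m<n∨m≡n m≤N+1
  ... | inj₂ ≡.refl = refl
  ... | inj₁ (s≤s m≤N) = begin
    Σ≤ m f             ≈⟨ Σ-extend m N f m≤N (λ i m<i i≤N → f≈0 i m<i (ℕ.m≤n⇒m≤1+n i≤N)) ⟩
    Σ≤ N f             ≈⟨ +-identityʳ _ ⟨
    Σ≤ N f + 0#        ≈⟨ +-congˡ (f≈0 (suc N) (s≤s m≤N) ℕ.≤-refl) ⟨
    Σ≤ N f + f (suc N) ∎

  Σ-choose-extend : ∀ m N → m ℕ.≤ N → (f : ℕ → Carrier) →
                    Σ≤ m (λ i → (m C i) · f i) ≈ Σ≤ N (λ i → (m C i) · f i)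
  Σ-choose-extend m N m≤N f = Σ-extend m N _ m≤N (λ i m<i _ → reflexive (≡.cong (_· f i) (k>n⇒nCk≡0 m<i)))

  Σ-single : ∀ N k (f : ℕ → Carrier) → k ℕ.≤ N → (∀ i → i ℕ.≤ N → i ≢ k → f i ≈ 0#) →
             Σ≤ N f ≈ f k
  Σ-single zero    zero f _   _   = refl
  Σ-single (suc N) k    f k≤N+1 f≈0 with ℕ.m≤n⇒m<n∨m≡n k≤N+1
  ... | inj₁ (s≤s k≤N) = begin
    Σ≤ N f + f (suc N) ≈⟨ +-cong (Σ-single N k f k≤N (λ i i≤N → f≈0 i (ℕ.m≤n⇒m≤1+n i≤N)))
                                 (f≈0 (suc N) ℕ.≤-refl (ℕ.<⇒≢ (s≤s k≤N) ∘ ≡.sym)) ⟩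
    f k + 0#           ≈⟨ +-identityʳ _ ⟩
    f k                ∎
  ... | inj₂ ≡.refl = begin
    Σ≤ N f + f (suc N) ≈⟨ +-congʳ (Σ-zero N f (λ i i≤N → f≈0 i (ℕ.m≤n⇒m≤1+n i≤N) (ℕ.<⇒≢ (s≤s i≤N)))) ⟩
    0# + f (suc N)     ≈⟨ +-identityˡ _ ⟩
    f (suc N)          ∎

  Σ-swap : ∀ n m (F : ℕ → ℕ → Carrier) →
           Σ≤ n (λ i → Σ≤ m (F i)) ≈ Σ≤ m (λ j → Σ≤ n (λ i → F i j))
  Σ-swap zero    m F = refl
  Σ-swap (suc n) m F = trans (+-congʳ (Σ-swap n m F)) (sym (Σ-+ m _ _))

  Σ-reverse : ∀ n (f : ℕ → Carrier) → Σ≤ n f ≈ Σ≤ n (λ i → f (n ℕ.∸ i))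
  Σ-reverse zero    f = refl
  Σ-reverse (suc n) f = begin
    Σ≤ n f + f (suc n)                       ≈⟨ +-comm _ _ ⟩
    f (suc n) + Σ≤ n f                       ≈⟨ +-congˡ (Σ-reverse n f) ⟩
    f (suc n) + Σ≤ n (λ i → f (n ℕ.∸ i))     ≈⟨ Σ-front n _ ⟨
    Σ≤ (suc n) (λ i → f (suc n ℕ.∸ i))       ∎

  Σ-triangle : ∀ n (F : ℕ → ℕ → Carrier) →
               Σ≤ n (λ i → Σ≤ i (λ l → F l (i ℕ.∸ l))) ≈ Σ≤ n (λ l → Σ≤ (n ℕ.∸ l) (F l))
  Σ-triangle zero    F = refl
  Σ-triangle (suc n) F = begin
    Σ≤ n (λ i → Σ≤ i (λ l → F l (i ℕ.∸ l))) + (Σ≤ n (λ l → F l (suc n ℕ.∸ l)) + F (suc n) (n ℕ.∸ n))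
      ≈⟨ +-congʳ (Σ-triangle n F) ⟩
    Σ≤ n (λ l → Σ≤ (n ℕ.∸ l) (F l)) + (Σ≤ n (λ l → F l (suc n ℕ.∸ l)) + F (suc n) (n ℕ.∸ n))
      ≈⟨ +-assoc _ _ _ ⟨
    (Σ≤ n (λ l → Σ≤ (n ℕ.∸ l) (F l)) + Σ≤ n (λ l → F l (suc n ℕ.∸ l))) + F (suc n) (n ℕ.∸ n)
      ≈⟨ +-cong (Σ-+ n _ _) (reflexive (≡.cong (F (suc n)) (≡.sym (ℕ.n∸n≡0 n)))) ⟨
    Σ≤ n (λ l → Σ≤ (n ℕ.∸ l) (F l) + F l (suc n ℕ.∸ l)) + Σ≤ 0 (F (suc n))
      ≈⟨ +-cong (Σ-cong n (λ l l≤n → ≡.subst (λ t → Σ≤ (n ℕ.∸ l) (F l) + F l t ≈ Σ≤ t (F l))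
                                              (≡.sym (ℕ.+-∸-assoc 1 l≤n)) refl))
                (reflexive (≡.cong (λ t → Σ≤ t (F (suc n))) (≡.sym (ℕ.n∸n≡0 n)))) ⟩
    Σ≤ n (λ l → Σ≤ (suc n ℕ.∸ l) (F l)) + Σ≤ (n ℕ.∸ n) (F (suc n))
      ∎

  ·-congʳ : ∀ k {a b} → a ≈ b → k · a ≈ k · b
  ·-congʳ zero    a≈b = refl
  ·-congʳ (suc k) a≈b = +-cong a≈b (·-congʳ k a≈b)

  ·-zeroʳ : ∀ k → k · 0# ≈ 0#
  ·-zeroʳ zero    = refl
  ·-zeroʳ (suc k) = trans (+-identityˡ _) (·-zeroʳ k)

  ·-distribˡ : ∀ k a b → k · (a + b) ≈ k · a + k · b
  ·-distribˡ zero    a b = sym (+-identityˡ 0#)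
  ·-distribˡ (suc k) a b = trans (+-congˡ (·-distribˡ k a b)) (interchange a b _ _)

  ·-+ : ∀ k l a → (k ℕ.+ l) · a ≈ k · a + l · a
  ·-+ zero    l a = sym (+-identityˡ _)
  ·-+ (suc k) l a = trans (+-congˡ (·-+ k l a)) (sym (+-assoc _ _ _))

  ·-* : ∀ k l a → (k ℕ.* l) · a ≈ k · (l · a)
  ·-* zero    l a = refl
  ·-* (suc k) l a = trans (·-+ l (k ℕ.* l) a) (+-congˡ (·-* k l a))

  *-· : ∀ k a b → a * (k · b) ≈ k · (a * b)
  *-· zero    a b = zeroʳ a
  *-· (suc k) a b = trans (distribˡ a b _) (+-congˡ (*-· k a b))

  Σ-· : ∀ n k (f : ℕ → Carrier) → k · Σ≤ n f ≈ Σ≤ n (λ i → k · f i)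
  Σ-· zero    k f = refl
  Σ-· (suc n) k f = trans (·-distribˡ k _ _) (+-congʳ (Σ-· n k f))

  ^-cong : ∀ n {a b} → a ≈ b → a ^ n ≈ b ^ n
  ^-cong zero    a≈b = refl
  ^-cong (suc n) a≈b = *-cong a≈b (^-cong n a≈b)

  ^-+ : ∀ a m n → a ^ (m ℕ.+ n) ≈ a ^ m * a ^ n
  ^-+ a zero    n = sym (*-identityˡ _)
  ^-+ a (suc m) n = trans (*-congˡ (^-+ a m n)) (sym (*-assoc _ _ _))

  ^-^ : ∀ a m k → (a ^ m) ^ k ≈ a ^ (m ℕ.* k)
  ^-^ a m k = trans (by-induction k) (reflexive (≡.cong (a ^_) (ℕ.*-comm k m)))
    where
    by-induction : ∀ k → (a ^ m) ^ k ≈ a ^ (k ℕ.* m)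
    by-induction zero    = refl
    by-induction (suc k) = trans (*-congˡ (by-induction k)) (sym (^-+ a m (k ℕ.* m)))

  ^-distrib-* : ∀ a b n → (a * b) ^ n ≈ a ^ n * b ^ n
  ^-distrib-* a b zero    = sym (*-identityˡ 1#)
  ^-distrib-* a b (suc n) = trans (*-congˡ (^-distrib-* a b n)) (*-interchange a b _ _)

  1^ : ∀ n → 1# ^ n ≈ 1#
  1^ zero    = refl
  1^ (suc n) = trans (*-identityˡ _) (1^ n)

  binomial : ∀ n a b → (a + b) ^ n ≈ Σ≤ n (λ k → (n C k) · (a ^ k * b ^ (n ℕ.∸ k)))
  binomial n a b = begin
    (a + b) ^ n          ≈⟨ same-power (a + b) n ⟩
    (a + b) LibExp.^ n   ≈⟨ LibBinomial.theorem a b (*-comm a b) n ⟩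
    ∑≤ n library-term    ≈⟨ LibSum.sum-cong-≋ {suc n} (λ k → sym (same-term (toℕ k))) ⟩
    ∑≤ n term            ≈⟨ same-sum n term ⟨
    Σ≤ n term            ∎
    where
    ∑≤ : ℕ → (ℕ → Carrier) → Carrier
    ∑≤ n f = LibSum.sum {suc n} (f ∘ toℕ)
    term library-term : ℕ → Carrier
    term k = (n C k) · (a ^ k * b ^ (n ℕ.∸ k))
    library-term k = (n C k) LibMult.× (a LibExp.^ k * b LibExp.^ (n ℕ.∸ k))
    same-multiple : ∀ k a → k · a ≈ k LibMult.× a
    same-multiple zero    a = refl
    same-multiple (suc k) a = +-congˡ (same-multiple k a)
    same-power : ∀ a n → a ^ n ≈ a LibExp.^ n
    same-power a zero    = refl
    same-power a (suc n) = *-congˡ (same-power a n)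
    same-sum : ∀ n (f : ℕ → Carrier) → Σ≤ n f ≈ ∑≤ n f
    same-sum zero    f = sym (+-identityʳ _)
    same-sum (suc n) f = trans (Σ-front n f) (+-congˡ (same-sum n (f ∘ suc)))
    same-term : ∀ k → term k ≈ library-term k
    same-term k = trans (same-multiple (n C k) _)
                        (LibMult.×-congʳ (n C k) (*-cong (same-power a k) (same-power b (n ℕ.∸ k))))

  δ : ℕ → ℕ → Carrier
  δ zero    zero    = 1#
  δ zero    (suc m) = 0#
  δ (suc l) zero    = 0#
  δ (suc l) (suc m) = δ l m

  δ-refl : ∀ k → δ k k ≈ 1#
  δ-refl zero    = refl
  δ-refl (suc k) = δ-refl k

  δ-≢ : ∀ l m → l ≢ m → δ l m ≈ 0#
  δ-≢ zero    zero    l≢m = ⊥-elim (l≢m ≡.refl)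
  δ-≢ zero    (suc m) _   = refl
  δ-≢ (suc l) zero    _   = refl
  δ-≢ (suc l) (suc m) l≢m = δ-≢ l m (l≢m ∘ ≡.cong suc)

  ·-·1# : ∀ k l u → k · (u * (l · 1#)) ≈ (k ℕ.* l) · u
  ·-·1# k l u = begin
    k · (u * (l · 1#))  ≈⟨ ·-congʳ k (*-· l u 1#) ⟩
    k · (l · (u * 1#))  ≈⟨ ·-congʳ k (·-congʳ l (*-identityʳ u)) ⟩
    k · (l · u)         ≈⟨ ·-* k l u ⟨
    (k ℕ.* l) · u       ∎

  square-of-sum : ∀ t → (t + 1#) ^ 2 ≈ (t ^ 2 + 1#) + 2 · t
  square-of-sum t = begin
    (t + 1#) * ((t + 1#) * 1#)      ≈⟨ *-congˡ (*-identityʳ _) ⟩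
    (t + 1#) * (t + 1#)             ≈⟨ distribˡ (t + 1#) t 1# ⟩
    (t + 1#) * t + (t + 1#) * 1#    ≈⟨ +-cong (distribʳ t t 1#) (*-identityʳ _) ⟩
    (t * t + 1# * t) + (t + 1#)     ≈⟨ +-cong (+-congˡ (*-identityˡ t)) (+-comm t 1#) ⟩
    (t * t + t) + (1# + t)          ≈⟨ interchange _ _ _ _ ⟩
    (t * t + 1#) + (t + t)          ≈⟨ +-cong (+-congʳ (*-congˡ (*-identityʳ t))) (+-congˡ (+-identityʳ t)) ⟨
    (t ^ 2 + 1#) + 2 · t            ∎

  quadratic-shift : ∀ x b t → x * (t + 1#) ^ 2 + b * t ≈ x * (t ^ 2 + 1#) + (b + 2 · x) * t
  quadratic-shift x b t = begin
    x * (t + 1#) ^ 2 + b * t                    ≈⟨ +-congʳ (*-congˡ (square-of-sum t)) ⟩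
    x * ((t ^ 2 + 1#) + 2 · t) + b * t          ≈⟨ +-congʳ (distribˡ x _ _) ⟩
    (x * (t ^ 2 + 1#) + x * (2 · t)) + b * t    ≈⟨ +-assoc _ _ _ ⟩
    x * (t ^ 2 + 1#) + (x * (2 · t) + b * t)    ≈⟨ +-congˡ (+-comm _ _) ⟩
    x * (t ^ 2 + 1#) + (b * t + x * (2 · t))    ≈⟨ +-congˡ (+-congˡ two-x-t) ⟩
    x * (t ^ 2 + 1#) + (b * t + (2 · x) * t)    ≈⟨ +-congˡ (distribʳ t b (2 · x)) ⟨
    x * (t ^ 2 + 1#) + (b + 2 · x) * t          ∎
    where
    two-x-t : x * (2 · t) ≈ (2 · x) * t
    two-x-t = trans (*-· 2 x t) (trans (·-congʳ 2 (*-comm x t)) (trans (sym (*-· 2 t x)) (*-comm t _)))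

module PowerSeries {c ℓ : Level} (R : CommutativeRing c ℓ) where
  open CommutativeRing R
  open RingOps R
  open RingSums R
  open import Relation.Binary.Reasoning.Setoid setoid

  Series : Set c
  Series = ℕ → Carrier

  infix 4 _≋_
  _≋_ : Series → Series → Set ℓ
  f ≋ g = ∀ n → f n ≈ g n

  infixl 6 _⊕_
  _⊕_ : Series → Series → Series
  (f ⊕ g) n = f n + g n

  infixl 7 _⊛_
  _⊛_ : Series → Series → Series
  (f ⊛ g) n = Σ≤ n (λ i → f i * g (n ℕ.∸ i))

  K : Carrier → Series
  K a zero    = a
  K a (suc n) = 0#

  T : Series
  T = δ 1

  K-⊛ : ∀ a f n → (K a ⊛ f) n ≈ a * f n
  K-⊛ a f n = Σ-single n 0 _ z≤n beyond-constant
    where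
    beyond-constant : ∀ i → i ℕ.≤ n → i ≢ 0 → K a i * f (n ℕ.∸ i) ≈ 0#
    beyond-constant zero    _ i≢0 = ⊥-elim (i≢0 ≡.refl)
    beyond-constant (suc i) _ _   = zeroˡ _

  T-⊛ : ∀ f n → (T ⊛ f) (suc n) ≈ f n
  T-⊛ f n = trans (Σ-single (suc n) 1 _ (s≤s z≤n) off-one) (*-identityˡ _)
    where
    off-one : ∀ i → i ℕ.≤ suc n → i ≢ 1 → T i * f (suc n ℕ.∸ i) ≈ 0#
    off-one i _ i≢1 = trans (*-congʳ (δ-≢ 1 i (i≢1 ∘ ≡.sym))) (zeroˡ _)

  -- The ring laws for the Cauchy product: commutativity by reversing the sum,
  -- associativity by reindexing the triangle of pairs (l, m) with l + m ≤ n.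
  ⊛-cong : ∀ {f f′ g g′} → f ≋ f′ → g ≋ g′ → f ⊛ g ≋ f′ ⊛ g′
  ⊛-cong f≋f′ g≋g′ n = Σ-cong n (λ i _ → *-cong (f≋f′ i) (g≋g′ (n ℕ.∸ i)))

  ⊛-comm : ∀ f g → f ⊛ g ≋ g ⊛ f
  ⊛-comm f g n = trans (Σ-reverse n _) (Σ-cong n (λ i i≤n →
    trans (*-comm _ _) (*-congʳ (reflexive (≡.cong g (ℕ.m∸[m∸n]≡n i≤n))))))

  ⊛-assoc : ∀ f g h → (f ⊛ g) ⊛ h ≋ f ⊛ (g ⊛ h)
  ⊛-assoc f g h n = begin
    Σ≤ n (λ i → Σ≤ i (λ l → f l * g (i ℕ.∸ l)) * h (n ℕ.∸ i))
      ≈⟨ Σ-cong n distribute ⟩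
    Σ≤ n (λ i → Σ≤ i (λ l → f l * (g (i ℕ.∸ l) * h (n ℕ.∸ l ℕ.∸ (i ℕ.∸ l)))))
      ≈⟨ Σ-triangle n (λ l m → f l * (g m * h (n ℕ.∸ l ℕ.∸ m))) ⟩
    Σ≤ n (λ l → Σ≤ (n ℕ.∸ l) (λ m → f l * (g m * h (n ℕ.∸ l ℕ.∸ m))))
      ≈⟨ Σ-cong n (λ l _ → Σ-*ˡ (n ℕ.∸ l) (f l) _) ⟨
    Σ≤ n (λ l → f l * Σ≤ (n ℕ.∸ l) (λ m → g m * h (n ℕ.∸ l ℕ.∸ m)))
      ∎
    where
    split : ∀ i l → l ℕ.≤ i → n ℕ.∸ i ≡ n ℕ.∸ l ℕ.∸ (i ℕ.∸ l)
    split i l l≤i = ≡.trans (≡.cong (n ℕ.∸_) (≡.sym (ℕ.m+[n∸m]≡n l≤i))) (≡.sym (ℕ.∸-+-assoc n l (i ℕ.∸ l)))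
    distribute : ∀ i → i ℕ.≤ n → Σ≤ i (λ l → f l * g (i ℕ.∸ l)) * h (n ℕ.∸ i)
                               ≈ Σ≤ i (λ l → f l * (g (i ℕ.∸ l) * h (n ℕ.∸ l ℕ.∸ (i ℕ.∸ l))))
    distribute i _ = trans (Σ-*ʳ i _ _) (Σ-cong i (λ l l≤i →
      trans (*-assoc _ _ _) (*-congˡ (*-congˡ (reflexive (≡.cong h (split i l l≤i)))))))

  ⊛-identityˡ : ∀ f → K 1# ⊛ f ≋ f
  ⊛-identityˡ f n = trans (K-⊛ 1# f n) (*-identityˡ _)

  ⊛-distribˡ : ∀ f g h → f ⊛ (g ⊕ h) ≋ f ⊛ g ⊕ f ⊛ h
  ⊛-distribˡ f g h n = trans (Σ-cong n (λ i _ → distribˡ _ _ _)) (Σ-+ n _ _)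

  series-ring : CommutativeRing c ℓ
  series-ring = record
    { Carrier = Series
    ; _≈_ = _≋_
    ; _+_ = _⊕_
    ; _*_ = _⊛_
    ; -_ = λ f n → - f n
    ; 0# = λ _ → 0#
    ; 1# = K 1#
    ; isCommutativeRing = record
      { isRing = record
        { +-isAbelianGroup = Pointwise.isAbelianGroup ℕ +-isAbelianGroup
        ; *-cong = ⊛-cong
        ; *-assoc = ⊛-assoc
        ; *-identity = ⊛-identityˡ , λ f n → trans (⊛-comm f (K 1#) n) (⊛-identityˡ f n)
        ; distrib = ⊛-distribˡ , λ f g h n → trans (⊛-comm (g ⊕ h) f n)
                      (trans (⊛-distribˡ f g h n) (+-cong (⊛-comm f g n) (⊛-comm f h n)))
        }
      ; *-comm = ⊛-comm
      }
    }

  module 𝕊 = RingOps series-ring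
  module 𝕊-Sums = RingSums series-ring
  open CommutativeSemigroupProperties (CommutativeRing.*-commutativeSemigroup series-ring)
    using () renaming (interchange to ⊛-interchange)

  Σ-coefficient : ∀ m (F : ℕ → Series) n → 𝕊.Σ≤ m F n ≈ Σ≤ m (λ k → F k n)
  Σ-coefficient zero    F n = refl
  Σ-coefficient (suc m) F n = +-congʳ (Σ-coefficient m F n)

  ·-coefficient : ∀ k f n → (k 𝕊.· f) n ≈ k · f n
  ·-coefficient zero    f n = refl
  ·-coefficient (suc k) f n = +-congˡ (·-coefficient k f n)

  T^-coefficient : ∀ l m → (T 𝕊.^ l) m ≈ δ l m
  T^-coefficient zero    zero    = refl
  T^-coefficient zero    (suc m) = refl
  T^-coefficient (suc l) zero    = zeroˡ _
  T^-coefficient (suc l) (suc m) = trans (T-⊛ (T 𝕊.^ l) m) (T^-coefficient l m)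

  T^-⊛ : ∀ s n f → s ℕ.≤ n → ((T 𝕊.^ s) ⊛ f) n ≈ f (n ℕ.∸ s)
  T^-⊛ zero    n       f _         = ⊛-identityˡ f n
  T^-⊛ (suc s) (suc n) f (s≤s s≤n) =
    trans (⊛-assoc T (T 𝕊.^ s) f (suc n)) (trans (T-⊛ ((T 𝕊.^ s) ⊛ f) n) (T^-⊛ s n f s≤n))

  K-^ : ∀ a k → K a 𝕊.^ k ≋ K (a ^ k)
  K-^ a zero    n = refl
  K-^ a (suc k) n = trans (K-⊛ a (K a 𝕊.^ k) n) (trans (*-congˡ (K-^ a k n)) (scale n))
    where
    scale : ∀ n → a * K (a ^ k) n ≈ K (a ^ suc k) n
    scale zero    = refl
    scale (suc n) = zeroʳ a

  K⊛-^ : ∀ x P k → (K x ⊛ P) 𝕊.^ k ≋ K (x ^ k) ⊛ P 𝕊.^ k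
  K⊛-^ x P k n = trans (𝕊-Sums.^-distrib-* (K x) P k n) (⊛-cong {g = P 𝕊.^ k} (K-^ x k) (λ _ → refl) n)

  binomial-coefficient : ∀ U N m → ((U ⊕ K 1#) 𝕊.^ N) m ≈ Σ≤ N (λ l → (N C l) · (U 𝕊.^ l) m)
  binomial-coefficient U N m = begin
    ((U ⊕ K 1#) 𝕊.^ N) m
      ≈⟨ 𝕊-Sums.binomial N U (K 1#) m ⟩
    𝕊.Σ≤ N (λ l → (N C l) 𝕊.· ((U 𝕊.^ l) ⊛ (K 1# 𝕊.^ (N ℕ.∸ l)))) m
      ≈⟨ Σ-coefficient N _ m ⟩
    Σ≤ N (λ l → ((N C l) 𝕊.· ((U 𝕊.^ l) ⊛ (K 1# 𝕊.^ (N ℕ.∸ l)))) m)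
      ≈⟨ Σ-cong N (λ l _ → trans (·-coefficient (N C l) _ m) (·-congʳ (N C l) (drop-one l m))) ⟩
    Σ≤ N (λ l → (N C l) · (U 𝕊.^ l) m)
      ∎
    where
    drop-one : ∀ l → (U 𝕊.^ l) ⊛ (K 1# 𝕊.^ (N ℕ.∸ l)) ≋ U 𝕊.^ l
    drop-one l n = trans (⊛-cong (λ _ → refl) (𝕊-Sums.1^ (N ℕ.∸ l)) n)
                         (CommutativeRing.*-identityʳ series-ring (U 𝕊.^ l) n)

  choose-coefficient : ∀ N k → k ℕ.≤ N → ((T ⊕ K 1#) 𝕊.^ N) k ≈ (N C k) · 1#
  choose-coefficient N k k≤N = begin
    ((T ⊕ K 1#) 𝕊.^ N) k              ≈⟨ binomial-coefficient T N k ⟩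
    Σ≤ N (λ l → (N C l) · (T 𝕊.^ l) k) ≈⟨ Σ-single N k _ k≤N off-diagonal ⟩
    (N C k) · (T 𝕊.^ k) k              ≈⟨ ·-congʳ (N C k) (trans (T^-coefficient k k) (δ-refl k)) ⟩
    (N C k) · 1#                       ∎
    where
    off-diagonal : ∀ l → l ℕ.≤ N → l ≢ k → (N C l) · (T 𝕊.^ l) k ≈ 0#
    off-diagonal l _ l≢k = trans (·-congʳ (N C l) (trans (T^-coefficient l k) (δ-≢ l k l≢k))) (·-zeroʳ (N C l))

  even-coefficient : ∀ N m → ((T 𝕊.^ 2 ⊕ K 1#) 𝕊.^ N) m ≈ Σ≤ N (λ l → (N C l) · δ (2 ℕ.* l) m)
  even-coefficient N m = trans (binomial-coefficient (T 𝕊.^ 2) N m) (Σ-cong N (λ l _ → ·-congʳ (N C l)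
    (trans (𝕊-Sums.^-^ T 2 l m) (T^-coefficient (2 ℕ.* l) m))))

  diagonal-coefficient : ∀ x b P n →
    ((K x ⊛ P ⊕ K b ⊛ T) 𝕊.^ n) n ≈ Σ≤ n (λ k → (n C k) · ((x ^ k * b ^ (n ℕ.∸ k)) * (P 𝕊.^ k) k))
  diagonal-coefficient x b P n = begin
    ((K x ⊛ P ⊕ K b ⊛ T) 𝕊.^ n) n
      ≈⟨ 𝕊-Sums.binomial n (K x ⊛ P) (K b ⊛ T) n ⟩
    𝕊.Σ≤ n (λ k → (n C k) 𝕊.· (term k)) n
      ≈⟨ Σ-coefficient n _ n ⟩
    Σ≤ n (λ k → ((n C k) 𝕊.· term k) n)
      ≈⟨ Σ-cong n (λ k k≤n → trans (·-coefficient (n C k) _ n) (·-congʳ (n C k) (term-coefficient k k≤n))) ⟩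
    Σ≤ n (λ k → (n C k) · ((x ^ k * b ^ (n ℕ.∸ k)) * (P 𝕊.^ k) k))
      ∎
    where
    term : ℕ → Series
    term k = (K x ⊛ P) 𝕊.^ k ⊛ (K b ⊛ T) 𝕊.^ (n ℕ.∸ k)
    term-coefficient : ∀ k → k ℕ.≤ n → term k n ≈ (x ^ k * b ^ (n ℕ.∸ k)) * (P 𝕊.^ k) k
    term-coefficient k k≤n = begin
      term k n
        ≈⟨ ⊛-cong (K⊛-^ x P k) (K⊛-^ b T s) n ⟩
      ((K (x ^ k) ⊛ P 𝕊.^ k) ⊛ (K (b ^ s) ⊛ T 𝕊.^ s)) n
        ≈⟨ trans (⊛-interchange (K (x ^ k)) (P 𝕊.^ k) (K (b ^ s)) (T 𝕊.^ s) n)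
                 (⊛-assoc (K (x ^ k)) (K (b ^ s)) (P 𝕊.^ k ⊛ T 𝕊.^ s) n) ⟩
      (K (x ^ k) ⊛ (K (b ^ s) ⊛ (P 𝕊.^ k ⊛ T 𝕊.^ s))) n
        ≈⟨ trans (K-⊛ (x ^ k) (K (b ^ s) ⊛ (P 𝕊.^ k ⊛ T 𝕊.^ s)) n) (*-congˡ (K-⊛ (b ^ s) (P 𝕊.^ k ⊛ T 𝕊.^ s) n)) ⟩
      x ^ k * (b ^ s * (P 𝕊.^ k ⊛ T 𝕊.^ s) n)
        ≈⟨ *-congˡ (*-congˡ (trans (⊛-comm (P 𝕊.^ k) (T 𝕊.^ s) n) (T^-⊛ s n (P 𝕊.^ k) (ℕ.m∸n≤m n k)))) ⟩
      x ^ k * (b ^ s * (P 𝕊.^ k) (n ℕ.∸ s))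
        ≈⟨ trans (sym (*-assoc _ _ _)) (*-congˡ (reflexive (≡.cong (P 𝕊.^ k) (ℕ.m∸[m∸n]≡n k≤n)))) ⟩
      (x ^ k * b ^ s) * (P 𝕊.^ k) k
        ∎
      where s = n ℕ.∸ k

module CentralBinomial {c ℓ : Level} (R : CommutativeRing c ℓ) where
  open CommutativeRing R
  open RingOps R
  open RingSums R
  open PowerSeries R
  open import Relation.Binary.Reasoning.Setoid setoid

  -- Against the coefficients of (t² + 1)ᵐ only even m = 2j survive, and there
  -- the coefficient is C(2j, j).
  even-terms : ∀ n (g : ℕ → Carrier) →
    Σ≤ n (λ m → (n C m) · (g m * Σ≤ m (λ l → (m C l) · δ (2 ℕ.* l) m)))
      ≈ Σ≤ n (λ j → paired n j · g (2 ℕ.* j))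
  even-terms n g = begin
    Σ≤ n (λ m → (n C m) · (g m * Σ≤ m (λ l → (m C l) · δ (2 ℕ.* l) m)))
      ≈⟨ Σ-cong n spread ⟩
    Σ≤ n (λ m → Σ≤ n (λ j → F j m))
      ≈⟨ Σ-swap n n F ⟨
    Σ≤ n (λ j → Σ≤ n (F j))
      ≈⟨ Σ-cong n (λ j _ → pick-even j) ⟩
    Σ≤ n (λ j → paired n j · g (2 ℕ.* j))
      ∎
    where
    F : ℕ → ℕ → Carrier
    F j m = (n C m) · (g m * ((m C j) · δ (2 ℕ.* j) m))
    F-odd : ∀ j m → 2 ℕ.* j ≢ m → F j m ≈ 0#
    F-odd j m 2j≢m = begin
      (n C m) · (g m * ((m C j) · δ (2 ℕ.* j) m)) ≈⟨ ·-congʳ (n C m) (*-congˡ (·-congʳ (m C j) (δ-≢ _ m 2j≢m))) ⟩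
      (n C m) · (g m * ((m C j) · 0#))            ≈⟨ ·-congʳ (n C m) (*-congˡ (·-zeroʳ (m C j))) ⟩
      (n C m) · (g m * 0#)                        ≈⟨ ·-congʳ (n C m) (zeroʳ (g m)) ⟩
      (n C m) · 0#                                ≈⟨ ·-zeroʳ (n C m) ⟩
      0#                                          ∎
    spread : ∀ m → m ℕ.≤ n → (n C m) · (g m * Σ≤ m (λ l → (m C l) · δ (2 ℕ.* l) m)) ≈ Σ≤ n (λ j → F j m)
    spread m m≤n = begin
      (n C m) · (g m * Σ≤ m (λ l → (m C l) · δ (2 ℕ.* l) m))
        ≈⟨ ·-congʳ (n C m) (*-congˡ (Σ-choose-extend m n m≤n (λ l → δ (2 ℕ.* l) m))) ⟩
      (n C m) · (g m * Σ≤ n (λ l → (m C l) · δ (2 ℕ.* l) m))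
        ≈⟨ trans (·-congʳ (n C m) (Σ-*ˡ n (g m) _)) (Σ-· n (n C m) _) ⟩
      Σ≤ n (λ j → F j m)
        ∎
    pick-even : ∀ j → Σ≤ n (F j) ≈ paired n j · g (2 ℕ.* j)
    pick-even j with 2 ℕ.* j ℕ.≤? n
    ... | yes 2j≤n = begin
      Σ≤ n (F j)        ≈⟨ Σ-single n (2 ℕ.* j) (F j) 2j≤n (λ m _ m≢2j → F-odd j m (m≢2j ∘ ≡.sym)) ⟩
      F j (2 ℕ.* j)     ≈⟨ ·-congʳ (n C (2 ℕ.* j)) (*-congˡ (·-congʳ ((2 ℕ.* j) C j) (δ-refl (2 ℕ.* j)))) ⟩
      (n C (2 ℕ.* j)) · (g (2 ℕ.* j) * (((2 ℕ.* j) C j) · 1#)) ≈⟨ ·-·1# (n C (2 ℕ.* j)) _ _ ⟩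
      paired n j · g (2 ℕ.* j) ∎
    ... | no 2j≰n = begin
      Σ≤ n (F j)   ≈⟨ Σ-zero n (F j) (λ m m≤n → F-odd j m (λ 2j≡m → 2j≰n (≡.subst (ℕ._≤ n) (≡.sym 2j≡m) m≤n))) ⟩
      0#           ≡⟨ ≡.cong (λ e → e ℕ.* ((2 ℕ.* j) C j) · g (2 ℕ.* j)) (k>n⇒nCk≡0 (ℕ.≰⇒> 2j≰n)) ⟨
      paired n j · g (2 ℕ.* j) ∎

  -- Σ_j C(n,2j) C(2j,j) x²ʲ (b + 2x)ⁿ⁻²ʲ = Σ_k C(n,k) C(2k,k) xᵏ bⁿ⁻ᵏ, by comparing
  -- the coefficients of tⁿ in (x(t² + 1) + (b + 2x) t)ⁿ = (x (t + 1)² + b t)ⁿ.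
  central-identity : ∀ n x b →
    Σ≤ n (λ j → paired n j · (x ^ (2 ℕ.* j) * (b + 2 · x) ^ (n ∸ 2 ℕ.* j)))
      ≈ Σ≤ n (λ k → ((n C k) ℕ.* ((2 ℕ.* k) C k)) · (x ^ k * b ^ (n ∸ k)))
  central-identity n x b = begin
    Σ≤ n (λ j → paired n j · (x ^ (2 ℕ.* j) * a ^ (n ∸ 2 ℕ.* j)))
      ≈⟨ even-terms n (λ m → x ^ m * a ^ (n ∸ m)) ⟨
    Σ≤ n (λ m → (n C m) · ((x ^ m * a ^ (n ∸ m)) * Σ≤ m (λ l → (m C l) · δ (2 ℕ.* l) m)))
      ≈⟨ Σ-cong n (λ m _ → ·-congʳ (n C m) (*-congˡ (even-coefficient m m))) ⟨
    Σ≤ n (λ m → (n C m) · ((x ^ m * a ^ (n ∸ m)) * (V 𝕊.^ m) m))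
      ≈⟨ diagonal-coefficient x a V n ⟨
    ((K x ⊛ V ⊕ K a ⊛ T) 𝕊.^ n) n
      ≈⟨ 𝕊-Sums.^-cong n shift n ⟨
    ((K x ⊛ W ⊕ K b ⊛ T) 𝕊.^ n) n
      ≈⟨ diagonal-coefficient x b W n ⟩
    Σ≤ n (λ k → (n C k) · ((x ^ k * b ^ (n ∸ k)) * (W 𝕊.^ k) k))
      ≈⟨ Σ-cong n (λ k _ → trans (·-congʳ (n C k) (*-congˡ (central k))) (·-·1# (n C k) _ _)) ⟩
    Σ≤ n (λ k → ((n C k) ℕ.* ((2 ℕ.* k) C k)) · (x ^ k * b ^ (n ∸ k)))
      ∎
    where
    a : Carrier
    a = b + 2 · x
    W V : Series
    W = (T ⊕ K 1#) 𝕊.^ 2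
    V = T 𝕊.^ 2 ⊕ K 1#
    central : ∀ k → (W 𝕊.^ k) k ≈ ((2 ℕ.* k) C k) · 1#
    central k = trans (𝕊-Sums.^-^ (T ⊕ K 1#) 2 k k) (choose-coefficient (2 ℕ.* k) k (ℕ.m≤n*m k 2))
    constant-a : K b ⊕ 2 𝕊.· K x ≋ K a
    constant-a zero    = refl
    constant-a (suc n) = trans (+-identityˡ _) (trans (+-identityˡ _) (+-identityˡ _))
    shift : K x ⊛ W ⊕ K b ⊛ T ≋ K x ⊛ V ⊕ K a ⊛ T
    shift m = trans (𝕊-Sums.quadratic-shift (K x) (K b) T m) (+-congˡ (⊛-cong {g = T} constant-a (λ _ → refl) m))

module TrinomialSums {c ℓ : Level} (R : CommutativeRing c ℓ) where
  open CommutativeRing R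
  open RingOps R
  open RingSums R
  open CentralBinomial R using (central-identity)
  open import Relation.Binary.Reasoning.Setoid setoid

  reorganise : ∀ n (G : ℕ → ℕ → Carrier) →
    Σ≤ n (λ i → Σ≤ ((n ∸ i) / 2) (λ j → trinomial n i j · G i j))
      ≈ Σ≤ n (λ j → Σ≤ n (λ i → (paired n j ℕ.* ((n ∸ 2 ℕ.* j) C i)) · G i j))
  reorganise n G = begin
    Σ≤ n (λ i → Σ≤ ((n ∸ i) / 2) (λ j → trinomial n i j · G i j))  ≈⟨ Σ-cong n (λ i _ → extend i) ⟩
    Σ≤ n (λ i → Σ≤ n (λ j → trinomial n i j · G i j))              ≈⟨ Σ-swap n n _ ⟩
    Σ≤ n (λ j → Σ≤ n (λ i → trinomial n i j · G i j))              ≈⟨ Σ-cong n (λ j _ → Σ-cong n (λ i _ → reorder i j)) ⟩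
    Σ≤ n (λ j → Σ≤ n (λ i → (paired n j ℕ.* ((n ∸ 2 ℕ.* j) C i)) · G i j)) ∎
    where
    extend : ∀ i → Σ≤ ((n ∸ i) / 2) (λ j → trinomial n i j · G i j) ≈ Σ≤ n (λ j → trinomial n i j · G i j)
    extend i = Σ-extend _ n _ (ℕ.≤-trans (m/n≤m (n ∸ i) 2) (ℕ.m∸n≤m n i))
      (λ j half<j _ → reflexive (≡.cong (_· G i j) (trinomial-vanishes n i j (half<⇒< (n ∸ i) j half<j))))
    reorder : ∀ i j → trinomial n i j · G i j ≈ (paired n j ℕ.* ((n ∸ 2 ℕ.* j) C i)) · G i j
    reorder i j = reflexive (≡.cong (_· G i j) (trinomial-reorder n i j))

  scaled-binomial : ∀ m N → m ℕ.≤ N → ∀ c u v w →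
    Σ≤ N (λ i → (c ℕ.* (m C i)) · (u * (v ^ i * w ^ (m ∸ i)))) ≈ c · (u * (v + w) ^ m)
  scaled-binomial m N m≤N c u v w = begin
    Σ≤ N (λ i → (c ℕ.* (m C i)) · (u * (v ^ i * w ^ (m ∸ i))))
      ≈⟨ Σ-cong N (λ i _ → trans (·-* c (m C i) _) (·-congʳ c (sym (*-· (m C i) u _)))) ⟩
    Σ≤ N (λ i → c · (u * ((m C i) · (v ^ i * w ^ (m ∸ i)))))
      ≈⟨ trans (·-congʳ c (Σ-*ˡ N u _)) (Σ-· N c _) ⟨
    c · (u * Σ≤ N (λ i → (m C i) · (v ^ i * w ^ (m ∸ i))))
      ≈⟨ ·-congʳ c (*-congˡ (Σ-choose-extend m N m≤N (λ i → v ^ i * w ^ (m ∸ i)))) ⟨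
    c · (u * Σ≤ m (λ i → (m C i) · (v ^ i * w ^ (m ∸ i))))
      ≈⟨ ·-congʳ c (*-congˡ (binomial m v w)) ⟨
    c · (u * (v + w) ^ m)
      ∎

  -- The first identity: the inner sums are expansions of (1 + y)ⁿ⁻²ʲ.
  first-identity : ∀ n x y →
    Σ≤ n (λ i → Σ≤ ((n ∸ i) / 2) (λ j → trinomial n i j · (x ^ j * y ^ i)))
      ≈ Σ≤ (n / 2) (λ k → paired n k · (x ^ k * (1# + y) ^ (n ∸ 2 ℕ.* k)))
  first-identity n x y = begin
    Σ≤ n (λ i → Σ≤ ((n ∸ i) / 2) (λ j → trinomial n i j · (x ^ j * y ^ i)))
      ≈⟨ reorganise n (λ i j → x ^ j * y ^ i) ⟩
    Σ≤ n (λ j → Σ≤ n (λ i → (paired n j ℕ.* ((n ∸ 2 ℕ.* j) C i)) · (x ^ j * y ^ i)))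
      ≈⟨ Σ-cong n (λ j _ → expand j) ⟩
    Σ≤ n (λ k → paired n k · (x ^ k * (1# + y) ^ (n ∸ 2 ℕ.* k)))
      ≈⟨ Σ-extend (n / 2) n _ (m/n≤m n 2) beyond-half ⟨
    Σ≤ (n / 2) (λ k → paired n k · (x ^ k * (1# + y) ^ (n ∸ 2 ℕ.* k)))
      ∎
    where
    beyond-half : ∀ k → n / 2 ℕ.< k → k ℕ.≤ n → paired n k · (x ^ k * (1# + y) ^ (n ∸ 2 ℕ.* k)) ≈ 0#
    beyond-half k half<k _ = reflexive (≡.cong (λ e → e ℕ.* ((2 ℕ.* k) C k) · (x ^ k * (1# + y) ^ (n ∸ 2 ℕ.* k)))
                                                (k>n⇒nCk≡0 (half<⇒< n k half<k)))
    expand : ∀ j → Σ≤ n (λ i → (paired n j ℕ.* ((n ∸ 2 ℕ.* j) C i)) · (x ^ j * y ^ i))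
                   ≈ paired n j · (x ^ j * (1# + y) ^ (n ∸ 2 ℕ.* j))
    expand j = begin
      Σ≤ n (λ i → (paired n j ℕ.* (m C i)) · (x ^ j * y ^ i))
        ≈⟨ Σ-cong n (λ i _ → ·-congʳ (paired n j ℕ.* (m C i)) (*-congˡ (trans (*-congˡ (1^ (m ∸ i))) (*-identityʳ _)))) ⟨
      Σ≤ n (λ i → (paired n j ℕ.* (m C i)) · (x ^ j * (y ^ i * 1# ^ (m ∸ i))))
        ≈⟨ scaled-binomial m n (ℕ.m∸n≤m n (2 ℕ.* j)) (paired n j) (x ^ j) y 1# ⟩
      paired n j · (x ^ j * (y + 1#) ^ m)
        ≈⟨ ·-congʳ (paired n j) (*-congˡ (^-cong m (+-comm y 1#))) ⟩
      paired n j · (x ^ j * (1# + y) ^ m)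
        ∎
      where m = n ∸ 2 ℕ.* j

  -- The second identity: the inner sums are expansions of (y + z)ⁿ⁻²ʲ, and with
  -- y + z = b + 2x what remains is the central binomial identity.
  second-identity : ∀ n x y z →
    Σ≤ n (λ i → Σ≤ ((n ∸ i) / 2) (λ j → trinomial n i j · (x ^ (2 ℕ.* j) * y ^ i * z ^ (n ∸ 2 ℕ.* j ∸ i))))
      ≈ Σ≤ n (λ k → ((n C k) ℕ.* ((2 ℕ.* k) C k)) · (x ^ k * (y + z - 2 · x) ^ (n ∸ k)))
  second-identity n x y z = begin
    Σ≤ n (λ i → Σ≤ ((n ∸ i) / 2) (λ j → trinomial n i j · (x ^ (2 ℕ.* j) * y ^ i * z ^ (n ∸ 2 ℕ.* j ∸ i))))
      ≈⟨ reorganise n (λ i j → x ^ (2 ℕ.* j) * y ^ i * z ^ (n ∸ 2 ℕ.* j ∸ i)) ⟩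
    Σ≤ n (λ j → Σ≤ n (λ i → (paired n j ℕ.* ((n ∸ 2 ℕ.* j) C i)) · (x ^ (2 ℕ.* j) * y ^ i * z ^ (n ∸ 2 ℕ.* j ∸ i))))
      ≈⟨ Σ-cong n (λ j _ → expand j) ⟩
    Σ≤ n (λ j → paired n j · (x ^ (2 ℕ.* j) * (b + 2 · x) ^ (n ∸ 2 ℕ.* j)))
      ≈⟨ central-identity n x b ⟩
    Σ≤ n (λ k → ((n C k) ℕ.* ((2 ℕ.* k) C k)) · (x ^ k * b ^ (n ∸ k)))
      ∎
    where
    b : Carrier
    b = y + z - 2 · x
    y+z≈b+2x : y + z ≈ b + 2 · x
    y+z≈b+2x = sym (begin
      (y + z) + - (2 · x) + 2 · x    ≈⟨ +-assoc _ _ _ ⟩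
      (y + z) + (- (2 · x) + 2 · x)  ≈⟨ +-congˡ (-‿inverseˡ _) ⟩
      (y + z) + 0#                   ≈⟨ +-identityʳ _ ⟩
      y + z                          ∎)
    expand : ∀ j → Σ≤ n (λ i → (paired n j ℕ.* ((n ∸ 2 ℕ.* j) C i)) · (x ^ (2 ℕ.* j) * y ^ i * z ^ (n ∸ 2 ℕ.* j ∸ i)))
                   ≈ paired n j · (x ^ (2 ℕ.* j) * (b + 2 · x) ^ (n ∸ 2 ℕ.* j))
    expand j = begin
      Σ≤ n (λ i → (paired n j ℕ.* (m C i)) · (x ^ (2 ℕ.* j) * y ^ i * z ^ (m ∸ i)))
        ≈⟨ Σ-cong n (λ i _ → ·-congʳ (paired n j ℕ.* (m C i)) (*-assoc _ _ _)) ⟩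
      Σ≤ n (λ i → (paired n j ℕ.* (m C i)) · (x ^ (2 ℕ.* j) * (y ^ i * z ^ (m ∸ i))))
        ≈⟨ scaled-binomial m n (ℕ.m∸n≤m n (2 ℕ.* j)) (paired n j) (x ^ (2 ℕ.* j)) y z ⟩
      paired n j · (x ^ (2 ℕ.* j) * (y + z) ^ m)
        ≈⟨ ·-congʳ (paired n j) (*-congˡ (^-cong m y+z≈b+2x)) ⟩
      paired n j · (x ^ (2 ℕ.* j) * (b + 2 · x) ^ m)
        ∎
      where m = n ∸ 2 ℕ.* j

-- Theorem 2.5.
theorem2p5 : ∀ {c ℓ} (R : CommutativeRing c ℓ) → let open CommutativeRing R in let open RingOps R in
    ∀ (n : ℕ) → n ≥ 1 → ∀ (x y z : Carrier) →
      (Σ≤ n (λ i → Σ≤ ((n ∸ i) / 2) (λ j → ((n C i) *ℕ ((n ∸ i) C j) *ℕ ((n ∸ j ∸ i) C j)) · ((x ^ j) * (y ^ i))))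
        ≈ Σ≤ (n / 2) (λ k → ((n C (2 *ℕ k)) *ℕ ((2 *ℕ k) C k)) · ((x ^ k) * ((1# + y) ^ (n ∸ 2 *ℕ k)))))
      × (Σ≤ n (λ i → Σ≤ ((n ∸ i) / 2) (λ j → ((n C i) *ℕ ((n ∸ i) C j) *ℕ ((n ∸ j ∸ i) C j)) · ((x ^ (2 *ℕ j)) * (y ^ i) * (z ^ (n ∸ 2 *ℕ j ∸ i)))))
        ≈ Σ≤ n (λ k → ((n C k) *ℕ ((2 *ℕ k) C k)) · ((x ^ k) * ((y + z - 2 · x) ^ (n ∸ k)))))
theorem2p5 R n _ x y z = first-identity n x y , second-identity n x y z
  where open TrinomialSums R
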